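{- For every integer $n\ge 0$, the Coxeter system $\mathbf{A_n}$ is cube-like with respect to a set $J$ such that $\iota_0(G(\mathbf{A_n}^J))\ge \lceil \tfrac{n}{2}\rceil !$.
   Context: $\mathbf{A_n}$ is the Coxeter system $(S_{n+1},\{(1\,2),(2\,3),\dots,(n\ n{+}1)\})$. For a Coxeter system $(W,S)$: $\ell(w)$ is the word length w.r.t. $S$; for $J\subseteq S$, $W_J=\langle J\rangle$, $W^J=\{w\in W\mid \ell(wj)>\ell(w)\ \forall j\in J\}$, and $G(W^J)$ is the graph on $W^J$ with $w\sim w'$ iff $w'=sw$ for some $s\in S$. $\iota_0(H)=\max\{|A|-|B|\mid V(H)=A\sqcup B,\ A,B\text{ independent}\}$. $(W,S)$ is cube-like with respect to $J\subseteq S$ if $W_J$ is abelian and $\iota_0(G(W^J))>0$. -}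

module Defs where

open import Data.Nat.Base using (ℕ; zero; suc; _+_; _≤_; _<_)
open import Data.Fin.Base using (Fin; inject₁)
open import Data.Fin.Properties using (_≟_)
open import Data.Fin.Subset using (Subset; _∈_)
open import Data.Vec.Base using (Vec; map; tabulate; lookup)
open import Data.List.Base using (List; []; _∷_; length; _++_)
open import Data.List.Relation.Unary.All using (All)
open import Data.List.Relation.Unary.Unique.Propositional using (Unique)
import Data.List.Membership.Propositional as LMem
open import Data.Product using (Σ; ∃; ∃-syntax; _×_)
open import Data.Sum using (_⊎_)
open import Data.Empty using (⊥)
open import Relation.Nullary using (¬_; yes; no)
open import Relation.Binary.PropositionalEquality using (_≡_)
open import Function using (id)

-- The Coxeter system A_n = (S_{n+1}, {(1 2), ..., (n n+1)}).
-- Points are Fin (suc n); the generators are indexed by i : Fin n,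
-- s_i being the transposition swapping (inject₁ i) and (suc i).
-- Group elements are permutations in one-line notation:
-- a vector v : Vec (Fin (suc n)) (suc n) represents x ↦ lookup v x.

Perm : ℕ → Set
Perm n = Vec (Fin (suc n)) (suc n)

swap : ∀ {n} → Fin n → Fin (suc n) → Fin (suc n)
swap i x with x ≟ inject₁ i
... | yes _ = Fin.suc i
... | no _ with x ≟ Fin.suc i
...   | yes _ = inject₁ i
...   | no _  = x

idPerm : ∀ {n} → Perm n
idPerm = tabulate id

lmul : ∀ {n} → Fin n → Perm n → Perm n
lmul i w = map (swap i) w

rmul : ∀ {n} → Perm n → Fin n → Perm n
rmul w j = tabulate (λ x → lookup w (swap j x))

Word : ℕ → Set
Word n = List (Fin n)

eval : ∀ {n} → Word n → Perm n
eval []      = idPerm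
eval (i ∷ u) = lmul i (eval u)

InW : ∀ {n} → Perm n → Set
InW {n} w = ∃[ u ] eval {n} u ≡ w

HasLength : ∀ {n} → Perm n → ℕ → Set
HasLength {n} w k =
  (∃[ u ] (length u ≡ k × eval {n} u ≡ w)) ×
  (∀ (u : Word n) → eval u ≡ w → k ≤ length u)

-- W_J is abelian: any two elements of W_J = ⟨J⟩ commute.
-- (Since generators are involutions, ⟨J⟩ = {eval u | all letters of u in J}.)
InWJsub : ∀ {n} → Subset n → Perm n → Set
InWJsub {n} J w = ∃[ u ] (All (_∈ J) u × eval {n} u ≡ w)

WJAbelian : ∀ {n} → Subset n → Set
WJAbelian {n} J = ∀ (x y : Perm n) → InWJsub J x → InWJsub J y →
  ∀ (u v : Word n) → eval u ≡ x → eval v ≡ y → eval (u ++ v) ≡ eval (v ++ u)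

InWJ : ∀ {n} → Subset n → Perm n → Set
InWJ {n} J w = InW w ×
  (∀ (j : Fin n) → j ∈ J → ∀ (k k' : ℕ) →
     HasLength w k → HasLength (rmul w j) k' → k < k')

Adj : ∀ {n} → Perm n → Perm n → Set
Adj {n} w w' = ∃[ s ] w' ≡ lmul {n} s w

open LMem using () renaming (_∈_ to _∈L_)

Independent : ∀ {n} → List (Perm n) → Set
Independent {n} A = ∀ (x y : Perm n) → x ∈L A → y ∈L A → ¬ Adj x y

-- ι₀(G(W^J)) ≥ k, i.e. there is a partition V = A ⊔ B into independent
-- sets with |A| - |B| ≥ k  (ι₀ is the maximum of |A| - |B| over such
-- partitions; the vertex set is finite, so "max ≥ k" unfolds to this).
IotaAtLeast : ∀ {n} → Subset n → ℕ → Set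
IotaAtLeast {n} J k = Σ (List (Perm n)) λ A → Σ (List (Perm n)) λ B →
  Unique A × Unique B ×
  (∀ x → x ∈L A → InWJ J x) × (∀ x → x ∈L B → InWJ J x) ×
  (∀ x → InWJ J x → x ∈L A ⊎ x ∈L B) ×
  (∀ x → x ∈L A → x ∈L B → ⊥) ×
  Independent A × Independent B ×
  length B + k ≤ length A

CubeLike : ∀ {n} → Subset n → Set
CubeLike J = WJAbelian J × IotaAtLeast J 1

-- Take J = {s₁, s₃, …}; these generators commute pairwise, so W_J is abelian. The length of a
-- permutation is its number of inversions, hence W^J consists of the permutations whose one-line
-- notation increases on each block of positions {2k, 2k+1}, and left multiplication by a generator
-- changes the parity of the length: the even and the odd elements of W^J are independent sets A, B
-- partitioning G(W^J). Call w paired if each block holds a value pair {2m, 2m+1}; otherwise let s be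
-- the generator swapping the value pair of the smaller entry of the first block that does not.
-- Then w ↦ s w is a parity-reversing involution on the unpaired elements of W^J, while the paired
-- ones are even, one for each of the ⌈n/2⌉! orders of the pairs. Hence |A| − |B| ≥ ⌈n/2⌉!.

module Submission where

open import Defs
open import Data.Bool.Base using (Bool; true; false; not; if_then_else_)
open import Data.Bool.Properties as Boolₚ using (not-involutive; ¬-not; not-¬)
open import Data.Empty using (⊥; ⊥-elim)
open import Data.Unit using (⊤; tt)
open import Data.Fin.Base as Fin using (Fin; zero; suc; toℕ; inject₁; _↑ʳ_)
open import Data.Fin.Subset as Subset using (Subset; inside; outside)
import Data.Fin.Properties as Finₚ
open import Data.Nat.Base as ℕ using (ℕ; zero; suc; _+_; _*_; _≤_; _<_; z≤n; s≤s; ⌊_/2⌋; ⌈_/2⌉; _!)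
import Data.Nat.Properties as ℕ
open import Algebra.Properties.CommutativeSemigroup ℕ.+-commutativeSemigroup using (x∙yz≈y∙xz)
open import Data.Maybe.Base using (Maybe; just; nothing; maybe′)
import Data.Maybe.Base as Maybe
open import Data.Product using (_×_; _,_; proj₁; proj₂; ∃-syntax)
open import Data.Sum as Sum using (_⊎_; inj₁; inj₂)
open import Data.Vec.Base as Vec using (Vec; []; _∷_; map; tabulate; lookup; here; there)
import Data.Vec.Properties as Vecₚ
open import Data.Vec.Relation.Unary.All as All using (All; []; _∷_)
import Data.Vec.Relation.Unary.All.Properties as AllProps
open import Data.Vec.Membership.Propositional using () renaming (_∈_ to _∈ᵛ_)
open import Data.Vec.Relation.Unary.Any using (here; there)
open import Data.Vec.Relation.Unary.AllPairs using ([]; _∷_)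
open import Data.Vec.Relation.Unary.Linked using (Linked; []; [-]; _∷_)
open import Data.Vec.Relation.Unary.Unique.Propositional using (Unique)
import Data.Vec.Relation.Unary.Unique.Propositional.Properties as Uniqueₚ
import Data.Vec.Relation.Unary.AllPairs as AllPairs
open import Data.List.Base as List
  using (List; []; _∷_; length; _++_; [_]; _∷ʳ_; allFin; cartesianProductWith; filter; deduplicate)
import Data.List.Properties as Listₚ
import Data.List.Relation.Unary.All as ListAll
import Data.List.Relation.Unary.Unique.Propositional as ListUnique
import Data.List.Relation.Unary.Unique.Propositional.Properties as ListUniqueₚ
open import Data.List.Relation.Unary.AllPairs using ([]; _∷_)
open import Data.List.Membership.Propositional using (_∈_)
open import Data.List.Relation.Unary.Any using (here; there)
open import Data.List.Membership.Propositional.Properties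
  using ( ∈-cartesianProductWith⁻; ∈-cartesianProductWith⁺; ∈-allFin; ∈-filter⁺; ∈-filter⁻
        ; ∈-deduplicate⁺; ∈-deduplicate⁻; ∈-map⁻; ∈-++⁻)
import Data.List.Relation.Unary.All.Properties as ListAllₚ
import Data.List.Relation.Unary.Unique.DecPropositional.Properties as ListUniqueDecₚ
open import Data.List.Relation.Unary.Any using (index; _─_)
open import Data.List.Reverse using (Reverse; []; _∶_∶ʳ_; reverseView)
open import Function using (id; _∘_)
open import Relation.Binary.Definitions using (tri<; tri≈; tri>)
open import Relation.Binary.PropositionalEquality hiding ([_])
open import Relation.Nullary using (¬_; yes; no; Dec; ¬?)
open import Relation.Nullary.Decidable using (_×-dec_)


lookup-ext : ∀ {A : Set} {k} {v w : Vec A k} → (∀ i → lookup v i ≡ lookup w i) → v ≡ w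
lookup-ext {v = v} {w} eq =
  trans (sym (Vecₚ.tabulate∘lookup v)) (trans (Vecₚ.tabulate-cong eq) (Vecₚ.tabulate∘lookup w))

map-injective : ∀ {A B : Set} {f : A → B} → (∀ {x y} → f x ≡ f y → x ≡ y) →
  ∀ {k} {xs ys : Vec A k} → map f xs ≡ map f ys → xs ≡ ys
map-injective f-inj {xs = []}     {[]}     _  = refl
map-injective f-inj {xs = x ∷ xs} {y ∷ ys} eq =
  cong₂ _∷_ (f-inj (Vecₚ.∷-injectiveˡ eq)) (map-injective f-inj (Vecₚ.∷-injectiveʳ eq))

swapAt : ∀ {A : Set} {k} → Fin k → Vec A (suc k) → Vec A (suc k)
swapAt zero    (x ∷ y ∷ v) = y ∷ x ∷ v
swapAt (suc j) (x ∷ v)     = x ∷ swapAt j v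

swapAt-involutive : ∀ {A : Set} {k} (j : Fin k) (v : Vec A (suc k)) → swapAt j (swapAt j v) ≡ v
swapAt-involutive zero    (x ∷ y ∷ v) = refl
swapAt-involutive (suc j) (x ∷ v)     = cong (x ∷_) (swapAt-involutive j v)

All-swapAt : ∀ {A : Set} {P : A → Set} {k} (j : Fin k) {v : Vec A (suc k)} → All P v → All P (swapAt j v)
All-swapAt zero    {_ ∷ _ ∷ _} (px ∷ py ∷ pv) = py ∷ px ∷ pv
All-swapAt (suc j) {_ ∷ _}     (px ∷ pv)      = px ∷ All-swapAt j pv

swapAt-unique : ∀ {A : Set} {k} (j : Fin k) {v : Vec A (suc k)} → Unique v → Unique (swapAt j v)
swapAt-unique zero    {_ ∷ _ ∷ _} ((x≢y ∷ x∉v) ∷ (y∉v ∷ uv)) = (x≢y ∘ sym ∷ y∉v) ∷ (x∉v ∷ uv)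
swapAt-unique (suc j) {_ ∷ _}     (x∉v ∷ uv)                 = All-swapAt j x∉v ∷ swapAt-unique j uv

AtStep : ∀ {A : Set} {k} → (A → A → Set) → Fin k → Vec A (suc k) → Set
AtStep R zero    (x ∷ y ∷ _) = R x y
AtStep R (suc j) (_ ∷ v)     = AtStep R j v

AtStep-swapAt : ∀ {A : Set} {k} {R : A → A → Set} (j : Fin k) (v : Vec A (suc k)) →
  AtStep R j v → AtStep (λ x y → R y x) j (swapAt j v)
AtStep-swapAt zero    (x ∷ y ∷ v) r = r
AtStep-swapAt (suc j) (x ∷ v)     r = AtStep-swapAt j v r

ascent-or-descent : ∀ {M k} {v : Vec (Fin M) (suc k)} → Unique v → (j : Fin k) →
  AtStep Fin._<_ j v ⊎ AtStep Fin._>_ j v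
ascent-or-descent {v = x ∷ y ∷ _} ((x≢y ∷ _) ∷ _) zero with Finₚ.<-cmp x y
... | tri< x<y _ _ = inj₁ x<y
... | tri≈ _ x≡y _ = ⊥-elim (x≢y x≡y)
... | tri> _ _ x>y = inj₂ x>y
ascent-or-descent {v = _ ∷ _} (_ ∷ u) (suc j) = ascent-or-descent u j

Blockwise : ∀ {A : Set} {k} → (A → A → Set) → Vec A k → Set
Blockwise R []          = ⊤
Blockwise R (_ ∷ [])    = ⊤
Blockwise R (x ∷ y ∷ v) = R x y × Blockwise R v

Blockwise-map : ∀ {A B : Set} {R : A → A → Set} {S : B → B → Set} {f : A → B} →
  (∀ {x y} → R x y → S (f x) (f y)) →
  ∀ {k} {v : Vec A k} → Blockwise R v → Blockwise S (map f v)
Blockwise-map f-mono {v = []}        _       = tt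
Blockwise-map f-mono {v = _ ∷ []}    _       = tt
Blockwise-map f-mono {v = _ ∷ _ ∷ _} (r , b) = f-mono r , Blockwise-map f-mono b

blockwise? : ∀ {A : Set} {R : A → A → Set} → (∀ x y → Dec (R x y)) →
  ∀ {k} (v : Vec A k) → Dec (Blockwise R v)
blockwise? R? []          = yes tt
blockwise? R? (_ ∷ [])    = yes tt
blockwise? R? (x ∷ y ∷ v) = R? x y ×-dec blockwise? R? v

-- for k beyond the last block of v the result is junk (the block goes to the front);
-- the uses below respect k + k ≤ L
insertBlock : ∀ {A : Set} {L} → ℕ → A → A → Vec A L → Vec A (suc (suc L))
insertBlock zero    a b v           = a ∷ b ∷ v
insertBlock (suc k) a b (x ∷ y ∷ v) = x ∷ y ∷ insertBlock k a b v
insertBlock (suc k) a b v           = a ∷ b ∷ v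

Blockwise-insertBlock : ∀ {A : Set} {R : A → A → Set} k {a b : A} {L} {v : Vec A L} → R a b →
  Blockwise R v → Blockwise R (insertBlock k a b v)
Blockwise-insertBlock zero                    r bv       = r , bv
Blockwise-insertBlock (suc k) {v = []}        r _        = r , tt
Blockwise-insertBlock (suc k) {v = _ ∷ []}    r _        = r , tt
Blockwise-insertBlock (suc k) {v = _ ∷ _ ∷ _} r (r′ , bv) = r′ , Blockwise-insertBlock k r bv

All-insertBlock : ∀ {A : Set} {P : A → Set} k {a b : A} {L} {v : Vec A L} → P a → P b →
  All P v → All P (insertBlock k a b v)
All-insertBlock zero                    pa pb pv              = pa ∷ pb ∷ pv
All-insertBlock (suc k) {v = []}        pa pb pv              = pa ∷ pb ∷ pv
All-insertBlock (suc k) {v = _ ∷ []}    pa pb pv              = pa ∷ pb ∷ pv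
All-insertBlock (suc k) {v = _ ∷ _ ∷ _} pa pb (px ∷ py ∷ pv) = px ∷ py ∷ All-insertBlock k pa pb pv

insertBlock-unique : ∀ {A : Set} k {a b : A} {L} {v : Vec A L} → Unique (a ∷ b ∷ v) → Unique (insertBlock k a b v)
insertBlock-unique zero                    u = u
insertBlock-unique (suc k) {v = []}        u = u
insertBlock-unique (suc k) {v = _ ∷ []}    u = u
insertBlock-unique (suc k) {v = _ ∷ _ ∷ _}
  ((a≢b ∷ a≢x ∷ a≢y ∷ a∉v) ∷ (b≢x ∷ b≢y ∷ b∉v) ∷ (x≢y ∷ x∉v) ∷ (y∉v ∷ uv)) =
  (x≢y ∷ All-insertBlock k (a≢x ∘ sym) (b≢x ∘ sym) x∉v) ∷
  All-insertBlock k (a≢y ∘ sym) (b≢y ∘ sym) y∉v ∷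
  insertBlock-unique k ((a≢b ∷ a∉v) ∷ (b∉v ∷ uv))

length-∷ʳ : ∀ {A : Set} (u : List A) (x : A) → length (u ∷ʳ x) ≡ suc (length u)
length-∷ʳ u x = trans (Listₚ.length-++ u) (ℕ.+-comm (length u) 1)

length-cartesianProductWith : ∀ {A B C : Set} (f : A → B → C) (xs : List A) (ys : List B) →
  length (cartesianProductWith f xs ys) ≡ length xs * length ys
length-cartesianProductWith f []       ys = refl
length-cartesianProductWith f (x ∷ xs) ys =
  trans (Listₚ.length-++ (List.map (f x) ys))
        (cong₂ _+_ (Listₚ.length-map (f x) ys) (length-cartesianProductWith f xs ys))

∈-─ : ∀ {A : Set} {x z : A} {xs : List A} (x∈ : x ∈ xs) → z ∈ xs → z ≢ x → z ∈ (xs ─ x∈)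
∈-─ (here refl) (here refl) z≢x = ⊥-elim (z≢x refl)
∈-─ (here refl) (there z∈)  _   = z∈
∈-─ (there x∈)  (here refl) _   = here refl
∈-─ (there x∈)  (there z∈)  z≢x = there (∈-─ x∈ z∈ z≢x)

Unique-⊆⇒length-≤ : ∀ {A : Set} {xs ys : List A} → ListUnique.Unique xs → (∀ {x} → x ∈ xs → x ∈ ys) →
  length xs ≤ length ys
Unique-⊆⇒length-≤ {xs = []}     _             _  = z≤n
Unique-⊆⇒length-≤ {xs = x ∷ xs} {ys} (x∉xs ∷ uxs) xs⊆ys =
  subst (suc (length xs) ≤_) (sym (Listₚ.length-removeAt′ ys (index x∈ys)))
    (s≤s (Unique-⊆⇒length-≤ uxs λ z∈ → ∈-─ x∈ys (xs⊆ys (there z∈)) (ListAll.lookup x∉xs z∈ ∘ sym)))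
  where x∈ys = xs⊆ys (here refl)

Unique-map⁺ : ∀ {A B : Set} {f : A → B} {xs : List A} →
  (∀ {x y} → x ∈ xs → y ∈ xs → f x ≡ f y → x ≡ y) →
  ListUnique.Unique xs → ListUnique.Unique (List.map f xs)
Unique-map⁺ {xs = []}     _   []            = []
Unique-map⁺ {xs = x ∷ xs} inj (x∉xs ∷ uxs) =
  ListAllₚ.map⁺ (ListAll.tabulate λ y∈ fx≡fy → ListAll.lookup x∉xs y∈ (inj (here refl) (there y∈) fx≡fy)) ∷
  Unique-map⁺ (λ x∈ y∈ → inj (there x∈) (there y∈)) uxs

allVecs : ∀ M k → List (Vec (Fin M) k)
allVecs M zero    = [ [] ]
allVecs M (suc k) = cartesianProductWith _∷_ (allFin M) (allVecs M k)

∈-allVecs : ∀ {M k} (v : Vec (Fin M) k) → v ∈ allVecs M k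
∈-allVecs []      = here refl
∈-allVecs (x ∷ v) = ∈-cartesianProductWith⁺ _∷_ (∈-allFin x) (∈-allVecs v)

suc-injective² : ∀ {a b : ℕ} → suc (suc a) ≡ suc (suc b) → a ≡ b
suc-injective² = ℕ.suc-injective ∘ ℕ.suc-injective

double-suc≰1 : ∀ k → ¬ (suc k + suc k ≤ 1)
double-suc≰1 k (s≤s k+1+k≤0) with subst (_≤ 0) (ℕ.+-suc k k) k+1+k≤0
... | ()

double-pred : ∀ {k L} → suc k + suc k ≤ suc (suc L) → k + k ≤ L
double-pred {k} {L} (s≤s k+1+k≤) = ℕ.≤-pred (subst (_≤ suc L) (ℕ.+-suc k k) k+1+k≤)

half+half≤ : ∀ t → ⌊ t /2⌋ + ⌊ t /2⌋ ≤ t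
half+half≤ zero          = z≤n
half+half≤ (suc zero)    = z≤n
half+half≤ (suc (suc t)) = s≤s (subst (_≤ suc t) (sym (ℕ.+-suc ⌊ t /2⌋ ⌊ t /2⌋)) (s≤s (half+half≤ t)))


-- Transpositions and words

swap-suc : ∀ {n} (i : Fin n) (z : Fin (suc n)) → swap (suc i) (suc z) ≡ suc (swap i z)
swap-suc i z with z Finₚ.≟ inject₁ i
... | yes _ = refl
... | no _ with z Finₚ.≟ suc i
...   | yes _ = refl
...   | no _  = refl

swap-involutive : ∀ {n} (i : Fin n) (z : Fin (suc n)) → swap i (swap i z) ≡ z
swap-involutive zero    zero             = refl
swap-involutive zero    (suc zero)       = refl
swap-involutive zero    (suc (suc z))    = refl
swap-involutive (suc i) zero             = refl
swap-involutive (suc i) (suc z)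
  rewrite swap-suc i z | swap-suc i (swap i z) = cong suc (swap-involutive i z)

swap-injective : ∀ {n} (i : Fin n) {a b : Fin (suc n)} → swap i a ≡ swap i b → a ≡ b
swap-injective i {a} {b} eq = begin
  a                 ≡⟨ swap-involutive i a ⟨
  swap i (swap i a) ≡⟨ cong (swap i) eq ⟩
  swap i (swap i b) ≡⟨ swap-involutive i b ⟩
  b                 ∎
  where open ≡-Reasoning

map-swap-involutive : ∀ {n k} (i : Fin n) (v : Vec (Fin (suc n)) k) → map (swap i) (map (swap i) v) ≡ v
map-swap-involutive i v =
  trans (sym (Vecₚ.map-∘ (swap i) (swap i) v)) (trans (Vecₚ.map-cong (swap-involutive i) v) (Vecₚ.map-id v))

lookup-swapAt : ∀ {A : Set} {k} (j : Fin k) (v : Vec A (suc k)) (z : Fin (suc k)) →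
  lookup (swapAt j v) z ≡ lookup v (swap j z)
lookup-swapAt zero    (x ∷ y ∷ v) zero          = refl
lookup-swapAt zero    (x ∷ y ∷ v) (suc zero)    = refl
lookup-swapAt zero    (x ∷ y ∷ v) (suc (suc z)) = refl
lookup-swapAt (suc j) (x ∷ v)     zero          = refl
lookup-swapAt (suc j) (x ∷ v)     (suc z) rewrite swap-suc j z = lookup-swapAt j v z

rmul≡swapAt : ∀ {n} (w : Perm n) (j : Fin n) → rmul w j ≡ swapAt j w
rmul≡swapAt w j = lookup-ext λ z →
  trans (Vecₚ.lookup∘tabulate (lookup w ∘ swap j) z) (sym (lookup-swapAt j w z))

rmul-unique : ∀ {n} {w : Perm n} j → Unique w → Unique (rmul w j)
rmul-unique {w = w} j uw = subst Unique (sym (rmul≡swapAt w j)) (swapAt-unique j uw)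

act : ∀ {n} → Word n → Fin (suc n) → Fin (suc n)
act []      z = z
act (i ∷ u) z = swap i (act u z)

lookup-eval : ∀ {n} (u : Word n) (z : Fin (suc n)) → lookup (eval u) z ≡ act u z
lookup-eval []      z = Vecₚ.lookup∘tabulate id z
lookup-eval (i ∷ u) z = trans (Vecₚ.lookup-map z (swap i) (eval u)) (cong (swap i) (lookup-eval u z))

eval≡⇒act≗ : ∀ {n} (u v : Word n) → eval u ≡ eval v → ∀ z → act u z ≡ act v z
eval≡⇒act≗ u v eq z = trans (sym (lookup-eval u z)) (trans (cong (λ w → lookup w z) eq) (lookup-eval v z))

act-++ : ∀ {n} (u v : Word n) (z : Fin (suc n)) → act (u ++ v) z ≡ act u (act v z)
act-++ []      v z = refl
act-++ (i ∷ u) v z = cong (swap i) (act-++ u v z)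

eval-∷ʳ : ∀ {n} (u : Word n) (j : Fin n) → eval (u ∷ʳ j) ≡ swapAt j (eval u)
eval-∷ʳ u j = lookup-ext λ z → begin
  lookup (eval (u ∷ʳ j)) z    ≡⟨ lookup-eval (u ∷ʳ j) z ⟩
  act (u ∷ʳ j) z              ≡⟨ act-++ u [ j ] z ⟩
  act u (swap j z)            ≡⟨ lookup-eval u (swap j z) ⟨
  lookup (eval u) (swap j z)  ≡⟨ lookup-swapAt j (eval u) z ⟨
  lookup (swapAt j (eval u)) z ∎
  where open ≡-Reasoning

eval-unique : ∀ {n} (u : Word n) → Unique (eval u)
eval-unique []      = Uniqueₚ.tabulate⁺ id
eval-unique (i ∷ u) = Uniqueₚ.map⁺ (swap-injective i) (eval-unique u)

InSupport : ∀ {n} → Fin n → Fin (suc n) → Set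
InSupport i z = toℕ z ≡ toℕ i ⊎ toℕ z ≡ suc (toℕ i)

swap-lower : ∀ {n} (i : Fin n) {z : Fin (suc n)} → toℕ z ≡ toℕ i → toℕ (swap i z) ≡ suc (toℕ i)
swap-lower zero    {zero}  _  = refl
swap-lower (suc i) {suc z} eq rewrite swap-suc i z = cong suc (swap-lower i (ℕ.suc-injective eq))

swap-upper : ∀ {n} (i : Fin n) {z : Fin (suc n)} → toℕ z ≡ suc (toℕ i) → toℕ (swap i z) ≡ toℕ i
swap-upper zero    {suc zero}    _  = refl
swap-upper zero    {suc (suc _)} ()
swap-upper (suc i) {suc z}       eq rewrite swap-suc i z = cong suc (swap-upper i (ℕ.suc-injective eq))

swap-outside : ∀ {n} (i : Fin n) {z : Fin (suc n)} → toℕ z ≢ toℕ i → toℕ z ≢ suc (toℕ i) → swap i z ≡ z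
swap-outside zero    {zero}        ≢i _    = ⊥-elim (≢i refl)
swap-outside zero    {suc zero}    _  ≢1+i = ⊥-elim (≢1+i refl)
swap-outside zero    {suc (suc z)} _  _    = refl
swap-outside (suc i) {zero}        _  _    = refl
swap-outside (suc i) {suc z}       ≢i ≢1+i rewrite swap-suc i z =
  cong suc (swap-outside i (≢i ∘ cong suc) (≢1+i ∘ cong suc))

data SwapCase {n} (i : Fin n) (z : Fin (suc n)) : Set where
  lower   : toℕ z ≡ toℕ i → toℕ (swap i z) ≡ suc (toℕ i) → SwapCase i z
  upper   : toℕ z ≡ suc (toℕ i) → toℕ (swap i z) ≡ toℕ i → SwapCase i z
  outside : toℕ z ≢ toℕ i → toℕ z ≢ suc (toℕ i) → swap i z ≡ z → SwapCase i z

swapCase : ∀ {n} (i : Fin n) (z : Fin (suc n)) → SwapCase i z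
swapCase i z with toℕ z ℕ.≟ toℕ i | toℕ z ℕ.≟ suc (toℕ i)
... | yes z≡i | _        = lower z≡i (swap-lower i z≡i)
... | no  _   | yes z≡i+1 = upper z≡i+1 (swap-upper i z≡i+1)
... | no  z≢i | no z≢i+1  = outside z≢i z≢i+1 (swap-outside i z≢i z≢i+1)

swap-mono : ∀ {n} (i : Fin n) {x y : Fin (suc n)} → x Fin.< y →
  ¬ (toℕ x ≡ toℕ i × toℕ y ≡ suc (toℕ i)) → swap i x Fin.< swap i y
swap-mono i {x} {y} x<y ¬adjacent with swapCase i x | swapCase i y
... | lower x≡ _     | lower y≡ _     = ⊥-elim (ℕ.<-irrefl (trans x≡ (sym y≡)) x<y)
... | lower x≡ _     | upper y≡ _     = ⊥-elim (¬adjacent (x≡ , y≡))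
... | lower x≡ x′≡   | outside _ y≢ y′≡ rewrite y′≡ =
  subst (ℕ._< toℕ y) (sym x′≡) (ℕ.≤∧≢⇒< (subst (ℕ._< toℕ y) x≡ x<y) (y≢ ∘ sym))
... | upper x≡ _     | lower y≡ _     = ⊥-elim (ℕ.<-asym (subst₂ ℕ._<_ x≡ y≡ x<y) (ℕ.n<1+n (toℕ i)))
... | upper x≡ _     | upper y≡ _     = ⊥-elim (ℕ.<-irrefl (trans x≡ (sym y≡)) x<y)
... | upper x≡ x′≡   | outside _ _ y′≡ rewrite y′≡ =
  subst (ℕ._< toℕ y) (sym x′≡) (ℕ.<-trans (ℕ.n<1+n (toℕ i)) (subst (ℕ._< toℕ y) x≡ x<y))
... | outside _ _ x′≡ | lower y≡ y′≡ rewrite x′≡ =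
  subst (toℕ x ℕ.<_) (sym y′≡) (ℕ.<-trans (subst (toℕ x ℕ.<_) y≡ x<y) (ℕ.n<1+n (toℕ i)))
... | outside x≢ _ x′≡ | upper y≡ y′≡ rewrite x′≡ =
  subst (toℕ x ℕ.<_) (sym y′≡) (ℕ.≤∧≢⇒< (ℕ.≤-pred (subst (toℕ x ℕ.<_) y≡ x<y)) x≢)
... | outside _ _ x′≡ | outside _ _ y′≡ rewrite x′≡ | y′≡ = x<y

swap-commute-apart : ∀ {n} (i j : Fin n) → suc (toℕ i) < toℕ j →
  ∀ z → swap i (swap j z) ≡ swap j (swap i z)
swap-commute-apart zero    (suc zero)    (s≤s ())
swap-commute-apart zero    (suc (suc j)) _ zero = refl
swap-commute-apart zero    (suc (suc j)) _ (suc zero)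
  rewrite swap-suc (suc j) zero = refl
swap-commute-apart zero    (suc (suc j)) _ (suc (suc z))
  rewrite swap-suc (suc j) (suc z) | swap-suc j z = refl
swap-commute-apart (suc i) (suc j) _ zero = refl
swap-commute-apart (suc i) (suc j) (s≤s i+1<j) (suc z)
  rewrite swap-suc j z | swap-suc i z | swap-suc i (swap j z) | swap-suc j (swap i z) =
  cong suc (swap-commute-apart i j i+1<j z)


-- Inversions, length and its parity

ltBit : ℕ → ℕ → ℕ
ltBit _       zero    = 0
ltBit zero    (suc _) = 1
ltBit (suc a) (suc b) = ltBit a b

ltBit-< : ∀ {a b} → a < b → ltBit a b ≡ 1
ltBit-< {zero}  {suc b} _         = refl
ltBit-< {suc a} {suc b} (s≤s a<b) = ltBit-< a<b

ltBit-≥ : ∀ {a b} → b ≤ a → ltBit a b ≡ 0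
ltBit-≥ {a}     {zero}  _         = refl
ltBit-≥ {suc a} {suc b} (s≤s b≤a) = ltBit-≥ b≤a

ltBit-suc : ∀ a b → a ≢ b → ltBit a (suc b) ≡ ltBit a b
ltBit-suc zero    zero    a≢b = ⊥-elim (a≢b refl)
ltBit-suc zero    (suc b) _   = refl
ltBit-suc (suc a) zero    _   = refl
ltBit-suc (suc a) (suc b) a≢b = ltBit-suc a b (a≢b ∘ cong suc)

below : ∀ {M k} → Fin M → Vec (Fin M) k → ℕ
below x []       = 0
below x (y ∷ ys) = ltBit (toℕ y) (toℕ x) + below x ys

inversions : ∀ {M k} → Vec (Fin M) k → ℕ
inversions []       = 0
inversions (x ∷ xs) = below x xs + inversions xs

below-swapAt : ∀ {M k} (x : Fin M) (j : Fin k) (v : Vec (Fin M) (suc k)) → below x (swapAt j v) ≡ below x v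
below-swapAt x zero    (a ∷ b ∷ v) = x∙yz≈y∙xz (ltBit (toℕ b) (toℕ x)) (ltBit (toℕ a) (toℕ x)) (below x v)
below-swapAt x (suc j) (a ∷ v)     = cong (ltBit (toℕ a) (toℕ x) +_) (below-swapAt x j v)

inversions-swapAt-ascent : ∀ {M k} (j : Fin k) (v : Vec (Fin M) (suc k)) →
  AtStep Fin._<_ j v → inversions (swapAt j v) ≡ suc (inversions v)
inversions-swapAt-ascent zero (x ∷ y ∷ w) x<y = begin
  (ltBit (toℕ x) (toℕ y) + below y w) + (below x w + inversions w)
    ≡⟨ cong (λ b → (b + below y w) + _) (ltBit-< x<y) ⟩
  suc (below y w + (below x w + inversions w))
    ≡⟨ cong suc (x∙yz≈y∙xz (below y w) (below x w) _) ⟩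
  suc (below x w + (below y w + inversions w))
    ≡⟨ cong (λ b → suc (b + below x w) + _) (ltBit-≥ (ℕ.<⇒≤ x<y)) ⟨
  suc ((ltBit (toℕ y) (toℕ x) + below x w) + (below y w + inversions w)) ∎
  where open ≡-Reasoning
inversions-swapAt-ascent (suc j) (x ∷ v) asc
  rewrite below-swapAt x j v | inversions-swapAt-ascent j v asc = ℕ.+-suc (below x v) (inversions v)

inversions-swapAt-descent : ∀ {M k} (j : Fin k) (v : Vec (Fin M) (suc k)) →
  AtStep Fin._>_ j v → inversions v ≡ suc (inversions (swapAt j v))
inversions-swapAt-descent j v desc =
  subst (λ w → inversions w ≡ suc (inversions (swapAt j v)))
        (swapAt-involutive j v)
        (inversions-swapAt-ascent j (swapAt j v) (AtStep-swapAt j v desc))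

inversions-swapAt : ∀ {M k} {v : Vec (Fin M) (suc k)} → Unique v → ∀ j →
  inversions (swapAt j v) ≡ suc (inversions v) ⊎ inversions v ≡ suc (inversions (swapAt j v))
inversions-swapAt {v = v} uv j with ascent-or-descent uv j
... | inj₁ asc  = inj₁ (inversions-swapAt-ascent j v asc)
... | inj₂ desc = inj₂ (inversions-swapAt-descent j v desc)

below-zero : ∀ {M k} (v : Vec (Fin (suc M)) k) → below zero v ≡ 0
below-zero []      = refl
below-zero (_ ∷ v) = below-zero v

inversions-map-suc : ∀ {M k} (v : Vec (Fin M) k) → inversions (map suc v) ≡ inversions v
inversions-map-suc []      = refl
inversions-map-suc (x ∷ v) = cong₂ _+_ (below-suc v) (inversions-map-suc v)
  where
  below-suc : ∀ {k} (v : Vec _ k) → below (suc x) (map suc v) ≡ below x v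
  below-suc []      = refl
  below-suc (y ∷ v) = cong (ltBit (toℕ y) (toℕ x) +_) (below-suc v)

inversions-id : ∀ m → inversions (tabulate {n = m} (id {A = Fin m})) ≡ 0
inversions-id zero = refl
inversions-id (suc m)
  rewrite Vecₚ.tabulate-∘ Fin.suc (id {A = Fin m}) | below-zero (map Fin.suc (tabulate {n = m} id))
        | inversions-map-suc (tabulate {n = m} id) = inversions-id m

even : ℕ → Bool
even zero          = true
even (suc zero)    = false
even (suc (suc n)) = even n

even-suc : ∀ n → even (suc n) ≡ not (even n)
even-suc zero          = refl
even-suc (suc zero)    = refl
even-suc (suc (suc n)) = even-suc n

even⇒odd-suc : ∀ a → even a ≡ true → even (suc a) ≡ false
even⇒odd-suc a ev = trans (even-suc a) (cong not ev)

even≢odd : ∀ {a b} → even a ≡ true → even b ≡ false → a ≢ b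
even≢odd ev od refl with trans (sym ev) od
... | ()

even-differ-by-one : ∀ {m n} → m ≡ suc n ⊎ n ≡ suc m → even m ≡ not (even n)
even-differ-by-one {n = n} (inj₁ refl) = even-suc n
even-differ-by-one {m}     (inj₂ refl) = trans (sym (not-involutive (even m))) (cong not (sym (even-suc m)))

even-double : ∀ c t → even (c + (c + t)) ≡ even t
even-double zero    t = refl
even-double (suc c) t rewrite ℕ.+-suc c (c + t) = even-double c t

inversions-eval-≤ : ∀ {n} (u : Word n) → inversions (eval u) ≤ length u
inversions-eval-≤ {n} u = go (reverseView u)
  where
  go : ∀ {u} → Reverse u → inversions (eval u) ≤ length u
  go [] = ℕ.≤-reflexive (inversions-id (suc n))
  go (u ∶ r ∶ʳ j) rewrite eval-∷ʳ u j | length-∷ʳ u j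
    with inversions-swapAt (eval-unique u) j
  ... | inj₁ up   rewrite up = s≤s (go r)
  ... | inj₂ down = ℕ.m≤n⇒m≤1+n (ℕ.≤-trans (ℕ.n≤1+n _) (subst (_≤ length u) down (go r)))

even-inversions-eval : ∀ {n} (u : Word n) → even (inversions (eval u)) ≡ even (length u)
even-inversions-eval {n} u = go (reverseView u)
  where
  go : ∀ {u} → Reverse u → even (inversions (eval u)) ≡ even (length u)
  go [] = cong even (inversions-id (suc n))
  go (u ∶ r ∶ʳ j) rewrite eval-∷ʳ u j | length-∷ʳ u j | even-suc (length u) =
    trans (even-differ-by-one (inversions-swapAt (eval-unique u) j)) (cong not (go r))

increasing-or-descent : ∀ {M k} {v : Vec (Fin M) (suc k)} → Unique v →
  Linked Fin._<_ v ⊎ ∃[ j ] AtStep Fin._>_ j v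
increasing-or-descent {v = _ ∷ []}    _          = inj₁ [-]
increasing-or-descent {v = _ ∷ _ ∷ _} uv@(_ ∷ uw) with ascent-or-descent uv zero
... | inj₂ x>y = inj₂ (zero , x>y)
... | inj₁ x<y with increasing-or-descent uw
...   | inj₁ inc      = inj₁ (x<y ∷ inc)
...   | inj₂ (j , d) = inj₂ (suc j , d)

increasing-≥-index : ∀ {M k} {x : Fin M} {xs : Vec (Fin M) k} → Linked Fin._<_ (x ∷ xs) →
  ∀ i → toℕ i + toℕ x ≤ toℕ (lookup (x ∷ xs) i)
increasing-≥-index                   _           zero    = ℕ.≤-refl
increasing-≥-index {x = x} {y ∷ _} (x<y ∷ inc) (suc i) = begin
  suc (toℕ i + toℕ x)  ≡⟨ ℕ.+-suc (toℕ i) (toℕ x) ⟨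
  toℕ i + suc (toℕ x)  ≤⟨ ℕ.+-monoʳ-≤ (toℕ i) x<y ⟩
  toℕ i + toℕ y        ≤⟨ increasing-≥-index inc i ⟩
  toℕ (lookup (y ∷ _) i) ∎
  where open ℕ.≤-Reasoning

increasing-≤-index : ∀ {M k} {v : Vec (Fin M) (suc k)} → Linked Fin._<_ v →
  ∀ i → toℕ (lookup v i) + suc k ≤ M + toℕ i
increasing-≤-index {M} {v = x ∷ []} _ zero = begin
  toℕ x + 1 ≡⟨ ℕ.+-comm (toℕ x) 1 ⟩
  suc (toℕ x) ≤⟨ Finₚ.toℕ<n x ⟩
  M           ≡⟨ ℕ.+-identityʳ M ⟨
  M + 0       ∎
  where open ℕ.≤-Reasoning
increasing-≤-index {M} {suc k} {x ∷ y ∷ _} (x<y ∷ inc) zero = begin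
  toℕ x + suc (suc k) ≡⟨ ℕ.+-suc (toℕ x) (suc k) ⟩
  suc (toℕ x) + suc k ≤⟨ ℕ.+-monoˡ-≤ (suc k) x<y ⟩
  toℕ y + suc k       ≤⟨ increasing-≤-index inc zero ⟩
  M + 0               ∎
  where open ℕ.≤-Reasoning
increasing-≤-index {M} {suc k} {_ ∷ y ∷ w} (_ ∷ inc) (suc i) = begin
  toℕ (lookup (y ∷ w) i) + suc (suc k) ≡⟨ ℕ.+-suc (toℕ (lookup (y ∷ w) i)) (suc k) ⟩
  suc (toℕ (lookup (y ∷ w) i) + suc k) ≤⟨ s≤s (increasing-≤-index inc i) ⟩
  suc (M + toℕ i)                      ≡⟨ ℕ.+-suc M (toℕ i) ⟨
  M + suc (toℕ i)                      ∎
  where open ℕ.≤-Reasoning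

increasing⇒idPerm : ∀ {n} {v : Perm n} → Linked Fin._<_ v → v ≡ idPerm
increasing⇒idPerm {n} {x ∷ xs} inc = lookup-ext λ i →
  trans (Finₚ.toℕ-injective (ℕ.≤-antisym (entry≤index i) (index≤entry i))) (sym (Vecₚ.lookup∘tabulate id i))
  where
  index≤entry : ∀ i → toℕ i ≤ toℕ (lookup (x ∷ xs) i)
  index≤entry i = ℕ.≤-trans (ℕ.m≤m+n (toℕ i) (toℕ x)) (increasing-≥-index inc i)
  entry≤index : ∀ i → toℕ (lookup (x ∷ xs) i) ≤ toℕ i
  entry≤index i = ℕ.+-cancelˡ-≤ (suc n) _ _
    (ℕ.≤-trans (ℕ.≤-reflexive (ℕ.+-comm (suc n) _)) (increasing-≤-index inc i))

-- bubble sort, recorded as a word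
sortingWord : ∀ {n} k {v : Perm n} → inversions v ≡ k → Unique v → ∃[ u ] length u ≡ k × eval u ≡ v
sortingWord {n} k {v} inv≡k uv with increasing-or-descent uv
... | inj₁ inc = [] , trans (sym (inversions-id (suc n))) (trans (cong inversions (sym v≡id)) inv≡k) , sym v≡id
  where v≡id = increasing⇒idPerm inc
... | inj₂ (j , desc) with k | trans (sym inv≡k) (inversions-swapAt-descent j v desc)
...   | suc k′ | k≡suc with sortingWord k′ (ℕ.suc-injective (sym k≡suc)) (swapAt-unique j uv)
...     | u , len≡ , eval≡ = u ∷ʳ j , trans (length-∷ʳ u j) (cong suc len≡) ,
          trans (eval-∷ʳ u j) (trans (cong (swapAt j) eval≡) (swapAt-involutive j v))

hasLength-inversions : ∀ {n} {w : Perm n} → Unique w → HasLength w (inversions w)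
hasLength-inversions {w = w} uw =
  sortingWord (inversions w) refl uw ,
  λ u eval≡ → subst (λ v → inversions v ≤ length u) eval≡ (inversions-eval-≤ u)

hasLength⇒inversions : ∀ {n} {w : Perm n} {k} → Unique w → HasLength w k → k ≡ inversions w
hasLength⇒inversions {w = w} uw ((u , len≡ , eval≡) , minimal) with sortingWord (inversions w) refl uw
... | u′ , len′≡ , eval′≡ = ℕ.≤-antisym
  (subst (_ ≤_) len′≡ (minimal u′ eval′≡))
  (subst (inversions w ≤_) len≡ (subst (λ v → inversions v ≤ length u) eval≡ (inversions-eval-≤ u)))

InW⇒Unique : ∀ {n} {w : Perm n} → InW w → Unique w
InW⇒Unique (u , refl) = eval-unique u

Unique⇒InW : ∀ {n} {w : Perm n} → Unique w → InW w
Unique⇒InW uw with sortingWord _ refl uw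
... | u , _ , eval≡ = u , eval≡

even-inversions-lmul : ∀ {n} {v : Perm n} (s : Fin n) → Unique v →
  even (inversions (lmul s v)) ≡ not (even (inversions v))
even-inversions-lmul s uv with Unique⇒InW uv
... | u , refl = begin
  even (inversions (eval (s ∷ u))) ≡⟨ even-inversions-eval (s ∷ u) ⟩
  even (suc (length u))            ≡⟨ even-suc (length u) ⟩
  not (even (length u))            ≡⟨ cong not (even-inversions-eval u) ⟨
  not (even (inversions (eval u))) ∎
  where open ≡-Reasoning


-- The alternate generators

-- s_i swaps the points i and i+1 (0-based), so this is J = {s₁, s₃, s₅, …} in the 1-based numbering
everyOther : ∀ n → Subset n
everyOther zero          = []
everyOther (suc zero)    = inside ∷ []
everyOther (suc (suc n)) = inside ∷ outside ∷ everyOther n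

Blockwise⇒AtStep : ∀ {A : Set} {R : A → A → Set} n {w : Vec A (suc n)} → Blockwise R w →
  ∀ j → j Subset.∈ everyOther n → AtStep R j w
Blockwise⇒AtStep (suc zero)    {_ ∷ _ ∷ []} (r , _) zero          here              = r
Blockwise⇒AtStep (suc (suc n)) {_ ∷ _ ∷ _}  (r , _) zero          here              = r
Blockwise⇒AtStep (suc (suc n)) {_ ∷ _ ∷ _}  (_ , b) (suc (suc j)) (there (there p)) = Blockwise⇒AtStep n b j p

AtStep⇒Blockwise : ∀ {A : Set} {R : A → A → Set} n {w : Vec A (suc n)} →
  (∀ j → j Subset.∈ everyOther n → AtStep R j w) → Blockwise R w
AtStep⇒Blockwise zero          {_ ∷ []}     r = tt
AtStep⇒Blockwise (suc zero)    {_ ∷ _ ∷ []} r = r zero here , tt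
AtStep⇒Blockwise (suc (suc n)) {_ ∷ _ ∷ _}  r =
  r zero here , AtStep⇒Blockwise n (λ j p → r (suc (suc j)) (there (there p)))

InWJ⁺ : ∀ {n} {w : Perm n} → Unique w → Blockwise Fin._<_ w → InWJ (everyOther n) w
InWJ⁺ {n} {w} uw inc = Unique⇒InW uw , λ j j∈J k k′ len len′ → begin-strict
  k                           ≡⟨ hasLength⇒inversions uw len ⟩
  inversions w                <⟨ ℕ.n<1+n _ ⟩
  suc (inversions w)          ≡⟨ inversions-swapAt-ascent j w (Blockwise⇒AtStep n inc j j∈J) ⟨
  inversions (swapAt j w)     ≡⟨ cong inversions (rmul≡swapAt w j) ⟨
  inversions (rmul w j)       ≡⟨ hasLength⇒inversions (rmul-unique j uw) len′ ⟨
  k′                          ∎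
  where open ℕ.≤-Reasoning

InWJ⁻ : ∀ {n} {w : Perm n} → InWJ (everyOther n) w → Unique w × Blockwise Fin._<_ w
InWJ⁻ {n} {w} (inW , longer) = uw , AtStep⇒Blockwise n ascent
  where
  uw = InW⇒Unique inW
  ascent : ∀ j → j Subset.∈ everyOther n → AtStep Fin._<_ j w
  ascent j j∈J with ascent-or-descent uw j
  ... | inj₁ asc  = asc
  ... | inj₂ desc = ⊥-elim (ℕ.<-asym shorter
    (longer j j∈J _ _ (hasLength-inversions uw) (hasLength-inversions (rmul-unique j uw))))
    where
    shorter : inversions (rmul w j) < inversions w
    shorter = subst (λ m → inversions (rmul w j) < m)
      (sym (trans (inversions-swapAt-descent j w desc) (cong (suc ∘ inversions) (sym (rmul≡swapAt w j)))))
      (ℕ.n<1+n _)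

swap-commute-everyOther : ∀ {n} {i j : Fin n} → i Subset.∈ everyOther n → j Subset.∈ everyOther n →
  ∀ z → swap i (swap j z) ≡ swap j (swap i z)
swap-commute-everyOther {i = i} {j} i∈J j∈J z with apart i∈J j∈J
  where
  apart : ∀ {n} {i j : Fin n} → i Subset.∈ everyOther n → j Subset.∈ everyOther n →
    i ≡ j ⊎ suc (toℕ i) < toℕ j ⊎ suc (toℕ j) < toℕ i
  apart {suc zero}    here              here              = inj₁ refl
  apart {suc (suc n)} here              here              = inj₁ refl
  apart {suc (suc n)} here              (there (there _)) = inj₂ (inj₁ (s≤s (s≤s z≤n)))
  apart {suc (suc n)} (there (there _)) here              = inj₂ (inj₂ (s≤s (s≤s z≤n)))
  apart {suc (suc n)} (there (there p)) (there (there q)) with apart p q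
  ... | inj₁ refl       = inj₁ refl
  ... | inj₂ (inj₁ i<j) = inj₂ (inj₁ (s≤s (s≤s i<j)))
  ... | inj₂ (inj₂ j<i) = inj₂ (inj₂ (s≤s (s≤s j<i)))
... | inj₁ refl       = refl
... | inj₂ (inj₁ i<j) = swap-commute-apart i j i<j z
... | inj₂ (inj₂ j<i) = sym (swap-commute-apart j i j<i z)

swap-act : ∀ {n} {i : Fin n} {v : Word n} → i Subset.∈ everyOther n → ListAll.All (Subset._∈ everyOther n) v →
  ∀ z → swap i (act v z) ≡ act v (swap i z)
swap-act i∈J ListAll.[]                  z = refl
swap-act i∈J (ListAll._∷_ {x = j} {xs = v} j∈J v⊆J) z =
  trans (swap-commute-everyOther i∈J j∈J (act v z)) (cong (swap j) (swap-act i∈J v⊆J z))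

act-commute : ∀ {n} {u v : Word n} →
  ListAll.All (Subset._∈ everyOther n) u → ListAll.All (Subset._∈ everyOther n) v →
  ∀ z → act u (act v z) ≡ act v (act u z)
act-commute ListAll.[]                    v⊆J z = refl
act-commute (ListAll._∷_ {x = i} i∈J u⊆J) v⊆J z =
  trans (cong (swap i) (act-commute u⊆J v⊆J z)) (swap-act i∈J v⊆J _)

everyOther-abelian : ∀ n → WJAbelian (everyOther n)
everyOther-abelian n x y (u₀ , u₀⊆J , refl) (v₀ , v₀⊆J , refl) u v u≡ v≡ = lookup-ext λ z → begin
  lookup (eval (u ++ v)) z ≡⟨ lookup-eval (u ++ v) z ⟩
  act (u ++ v) z           ≡⟨ act-++ u v z ⟩
  act u (act v z)          ≡⟨ eval≡⇒act≗ u u₀ u≡ _ ⟩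
  act u₀ (act v z)         ≡⟨ cong (act u₀) (eval≡⇒act≗ v v₀ v≡ z) ⟩
  act u₀ (act v₀ z)        ≡⟨ act-commute u₀⊆J v₀⊆J z ⟩
  act v₀ (act u₀ z)        ≡⟨ cong (act v₀) (eval≡⇒act≗ u u₀ u≡ z) ⟨
  act v₀ (act u z)         ≡⟨ eval≡⇒act≗ v v₀ v≡ _ ⟨
  act v (act u z)          ≡⟨ act-++ v u z ⟨
  act (v ++ u) z           ≡⟨ lookup-eval (v ++ u) z ⟨
  lookup (eval (v ++ u)) z ∎
  where open ≡-Reasoning


-- The parity-reversing involution

isPair : ∀ {k} → Fin k → Fin k → Bool
isPair zero          (suc zero)    = true
isPair (suc (suc x)) (suc (suc y)) = isPair x y
isPair _             _             = false

isPair-sound : ∀ {k} {x y : Fin k} → isPair x y ≡ true → even (toℕ x) ≡ true × toℕ y ≡ suc (toℕ x)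
isPair-sound {x = zero}        {suc zero}    _  = refl , refl
isPair-sound {x = suc (suc x)} {suc (suc y)} eq with isPair-sound {x = x} eq
... | ev , y≡ = ev , cong (ℕ.suc ∘ ℕ.suc) y≡

isPair-complete : ∀ {k} {x y : Fin k} → even (toℕ x) ≡ true → toℕ y ≡ suc (toℕ x) → isPair x y ≡ true
isPair-complete {x = zero}        {suc zero}    _  _  = refl
isPair-complete {x = suc (suc x)} {suc (suc y)} ev y≡ =
  isPair-complete {x = x} ev (suc-injective² y≡)
isPair-complete {x = zero}        {zero}        _  ()
isPair-complete {x = zero}        {suc (suc _)} _  ()
isPair-complete {x = suc zero}    {_}           () _
isPair-complete {x = suc (suc _)} {zero}        _  ()
isPair-complete {x = suc (suc _)} {suc zero}    _  ()

-- nothing exactly for the top value x = n with n even, which lies in no value pair {2m, 2m+1}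
pairGen : ∀ {n} → Fin (suc n) → Maybe (Fin n)
pairGen {zero}        zero          = nothing
pairGen {suc n}       zero          = just zero
pairGen {suc n}       (suc zero)    = just zero
pairGen {suc (suc n)} (suc (suc x)) = Maybe.map (Fin.suc ∘ Fin.suc) (pairGen {n} x)

pairGen-sound : ∀ {n} {x : Fin (suc n)} {i} → pairGen x ≡ just i → even (toℕ i) ≡ true × InSupport i x
pairGen-sound {suc n}       {zero}     refl = refl , inj₁ refl
pairGen-sound {suc n}       {suc zero} refl = refl , inj₂ refl
pairGen-sound {suc (suc n)} {suc (suc x)} eq with pairGen {n} x in eq′
pairGen-sound {suc (suc n)} {suc (suc x)} refl | just i with pairGen-sound {x = x} eq′
... | ev , inj₁ x≡ = ev , inj₁ (cong (ℕ.suc ∘ ℕ.suc) x≡)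
... | ev , inj₂ x≡ = ev , inj₂ (cong (ℕ.suc ∘ ℕ.suc) x≡)

pairGen-complete : ∀ {n} {x : Fin (suc n)} {i : Fin n} → even (toℕ i) ≡ true → InSupport i x →
  pairGen x ≡ just i
pairGen-complete {suc n}       {zero}        {zero}        _  _           = refl
pairGen-complete {suc n}       {suc zero}    {zero}        _  _           = refl
pairGen-complete {suc (suc n)} {suc (suc x)} {suc (suc i)} ev x∈
  rewrite pairGen-complete {x = x} {i} ev (Sum.map suc-injective² suc-injective² x∈) = refl
pairGen-complete {suc n}       {suc zero}    {suc zero}    () _
pairGen-complete {suc n}       {zero}        {suc _}       _  (inj₁ ())
pairGen-complete {suc n}       {zero}        {suc _}       _  (inj₂ ())
pairGen-complete {suc n}       {suc zero}    {suc (suc _)} _  (inj₁ ())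
pairGen-complete {suc n}       {suc zero}    {suc (suc _)} _  (inj₂ ())
pairGen-complete {suc (suc n)} {suc (suc _)} {zero}        _  (inj₁ ())
pairGen-complete {suc (suc n)} {suc (suc _)} {zero}        _  (inj₂ ())
pairGen-complete {suc (suc n)} {suc (suc _)} {suc zero}    () _

pairGen-total : ∀ {n} (x : Fin (suc n)) → toℕ x < n → ∃[ i ] pairGen x ≡ just i
pairGen-total {suc n}       zero          _               = zero , refl
pairGen-total {suc n}       (suc zero)    _               = zero , refl
pairGen-total {suc (suc n)} (suc (suc x)) (s≤s (s≤s x<n)) with pairGen-total x x<n
... | i , eq = suc (suc i) , cong (Maybe.map (Fin.suc ∘ Fin.suc)) eq

firstUnpaired : ∀ {n k} → Vec (Fin (suc n)) k → Maybe (Fin n)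
firstUnpaired []          = nothing
firstUnpaired (_ ∷ [])    = nothing
firstUnpaired (x ∷ y ∷ v) = if isPair x y then firstUnpaired v else pairGen x

firstUnpaired-sound : ∀ {n k} (v : Vec (Fin (suc n)) k) {i} → firstUnpaired v ≡ just i →
  even (toℕ i) ≡ true × ∃[ z ] z ∈ᵛ v × InSupport i z
firstUnpaired-sound (x ∷ y ∷ v) eq with isPair x y
... | true with firstUnpaired-sound v eq
...   | ev , z , z∈v , z∈ = ev , z , there (there z∈v) , z∈
firstUnpaired-sound (x ∷ y ∷ v) eq | false with pairGen-sound eq
... | ev , x∈ = ev , x , here refl , x∈

pair-avoids-pair : ∀ {I X Y Z} → even I ≡ true → even X ≡ true → Y ≡ suc X → (Z ≡ I ⊎ Z ≡ suc I) →
  X ≢ Z → Y ≢ Z → (X ≢ I × X ≢ suc I) × (Y ≢ I × Y ≢ suc I)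
pair-avoids-pair {I} {X} evI evX refl Z∈ X≢Z Y≢Z = (X≢I , X≢I+1) , (Y≢I , X≢I ∘ ℕ.suc-injective)
  where
  X≢I : X ≢ I
  X≢I refl = Sum.[ X≢Z ∘ sym , Y≢Z ∘ sym ] Z∈
  X≢I+1 : X ≢ suc I
  X≢I+1 = even≢odd evX (even⇒odd-suc I evI)
  Y≢I : suc X ≢ I
  Y≢I = even≢odd evI (even⇒odd-suc X evX) ∘ sym

swap-fixes-pair : ∀ {n} {i : Fin n} {x y z : Fin (suc n)} → isPair x y ≡ true → even (toℕ i) ≡ true →
  InSupport i z → x ≢ z → y ≢ z → swap i x ≡ x × swap i y ≡ y
swap-fixes-pair {i = i} {x} {y} x,y evI z∈ x≢z y≢z
  with isPair-sound {x = x} {y} x,y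
... | evX , y≡ with pair-avoids-pair evI evX y≡ z∈ (x≢z ∘ Finₚ.toℕ-injective) (y≢z ∘ Finₚ.toℕ-injective)
... | (x≢i , x≢i+1) , (y≢i , y≢i+1) = swap-outside i x≢i x≢i+1 , swap-outside i y≢i y≢i+1

swap-unpaired-block : ∀ {n} {i : Fin n} {x y : Fin (suc n)} → isPair x y ≡ false → pairGen x ≡ just i →
  x Fin.< y → swap i y ≡ y × isPair (swap i x) y ≡ false × pairGen (swap i x) ≡ just i × swap i x Fin.< y
swap-unpaired-block {i = i} {x} {y} unpaired gen x<y with pairGen-sound gen
... | evI , inj₁ x≡i = swap-outside i y≢i y≢i+1 , ¬-not still-unpaired , pairGen-complete evI (inj₂ x′≡) , x′<y
  where
  x′≡ = swap-lower i x≡i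
  y≢i : toℕ y ≢ toℕ i
  y≢i y≡i = ℕ.<-irrefl (trans x≡i (sym y≡i)) x<y
  y≢i+1 : toℕ y ≢ suc (toℕ i)
  y≢i+1 y≡ with trans (sym unpaired)
                   (isPair-complete (subst (λ a → even a ≡ true) (sym x≡i) evI) (trans y≡ (cong suc (sym x≡i))))
  ... | ()
  still-unpaired : isPair (swap i x) y ≢ true
  still-unpaired p = even≢odd (proj₁ (isPair-sound {x = swap i x} p)) (even⇒odd-suc (toℕ i) evI) x′≡
  x′<y : swap i x Fin.< y
  x′<y = subst (ℕ._< toℕ y) (sym x′≡) (ℕ.≤∧≢⇒< (subst (ℕ._< toℕ y) x≡i x<y) (y≢i+1 ∘ sym))
... | evI , inj₂ x≡i+1 = swap-outside i y≢i y≢i+1 , ¬-not still-unpaired , pairGen-complete evI (inj₁ x′≡) , x′<y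
  where
  x′≡ = swap-upper i x≡i+1
  y≢i : toℕ y ≢ toℕ i
  y≢i y≡i = ℕ.<-asym (subst₂ ℕ._<_ x≡i+1 y≡i x<y) (ℕ.n<1+n (toℕ i))
  y≢i+1 : toℕ y ≢ suc (toℕ i)
  y≢i+1 y≡ = ℕ.<-irrefl (trans x≡i+1 (sym y≡)) x<y
  still-unpaired : isPair (swap i x) y ≢ true
  still-unpaired p = y≢i+1 (trans (proj₂ (isPair-sound {x = swap i x} p)) (cong suc x′≡))
  x′<y : swap i x Fin.< y
  x′<y = subst (ℕ._< toℕ y) (sym x′≡) (ℕ.<-trans (ℕ.n<1+n (toℕ i)) (subst (ℕ._< toℕ y) x≡i+1 x<y))

Blockwise-map-swap : ∀ {n k} (i : Fin n) {c} {w : Vec (Fin (suc n)) k} → InSupport i c → All (c ≢_) w →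
  Blockwise Fin._<_ w → Blockwise Fin._<_ (map (swap i) w)
Blockwise-map-swap i {w = []}        _  _                     _         = tt
Blockwise-map-swap i {w = _ ∷ []}    _  _                     _         = tt
Blockwise-map-swap i {c} {a ∷ b ∷ w} c∈ (c≢a ∷ c≢b ∷ c∉w) (a<b , inc) =
  swap-mono i a<b ¬adjacent , Blockwise-map-swap i c∈ c∉w inc
  where
  ¬adjacent : ¬ (toℕ a ≡ toℕ i × toℕ b ≡ suc (toℕ i))
  ¬adjacent (a≡ , b≡) = Sum.[ (λ c≡ → c≢a (Finₚ.toℕ-injective (trans c≡ (sym a≡))))
                            , (λ c≡ → c≢b (Finₚ.toℕ-injective (trans c≡ (sym b≡)))) ] c∈

swap-firstUnpaired : ∀ {n k} {v : Vec (Fin (suc n)) k} {i} → Unique v → Blockwise Fin._<_ v →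
  firstUnpaired v ≡ just i → firstUnpaired (map (swap i) v) ≡ just i × Blockwise Fin._<_ (map (swap i) v)
swap-firstUnpaired {v = x ∷ y ∷ w} {i} ((_ ∷ x∉w) ∷ (y∉w ∷ uw)) (x<y , inc) eq with isPair x y in x,y
... | true with firstUnpaired-sound w eq
...   | evI , z , z∈w , z∈ with swap-fixes-pair x,y evI z∈ (All.lookup x∉w z∈w) (All.lookup y∉w z∈w)
...     | x′≡x , y′≡y with swap-firstUnpaired uw inc eq
...       | eq′ , inc′ rewrite x′≡x | y′≡y | x,y = eq′ , x<y , inc′
swap-firstUnpaired {v = x ∷ y ∷ w} {i} ((_ ∷ x∉w) ∷ _) (x<y , inc) eq | false
  with swap-unpaired-block x,y eq x<y
... | y′≡y , unpaired′ , gen′ , x′<y rewrite y′≡y | unpaired′ =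
  gen′ , x′<y , Blockwise-map-swap i (proj₂ (pairGen-sound eq)) x∉w inc

toggle : ∀ {n} → Perm n → Perm n
toggle v = maybe′ (λ i → lmul i v) v (firstUnpaired v)

toggle-involutive : ∀ {n} {v : Perm n} → Unique v → Blockwise Fin._<_ v → toggle (toggle v) ≡ v
toggle-involutive {v = v} uv inc with firstUnpaired v in eq
... | nothing rewrite eq = refl
... | just i rewrite proj₁ (swap-firstUnpaired uv inc eq) = map-swap-involutive i v

Paired : ∀ {n k} → Vec (Fin (suc n)) k → Set
Paired = Blockwise (λ x y → isPair x y ≡ true)

Paired⇒firstUnpaired≡nothing : ∀ {n k} {v : Vec (Fin (suc n)) k} → Paired v → firstUnpaired v ≡ nothing
Paired⇒firstUnpaired≡nothing {v = []}        _         = refl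
Paired⇒firstUnpaired≡nothing {v = _ ∷ []}    _         = refl
Paired⇒firstUnpaired≡nothing {v = _ ∷ _ ∷ _} (x,y , p) rewrite x,y = Paired⇒firstUnpaired≡nothing p

firstUnpaired≡nothing⇒Paired : ∀ {n k} {v : Vec (Fin (suc n)) k} → Blockwise Fin._<_ v →
  firstUnpaired v ≡ nothing → Paired v
firstUnpaired≡nothing⇒Paired {v = []}        _         _  = tt
firstUnpaired≡nothing⇒Paired {v = _ ∷ []}    _         _  = tt
firstUnpaired≡nothing⇒Paired {v = x ∷ y ∷ _} (x<y , inc) eq with isPair x y in x,y
... | true  = refl , firstUnpaired≡nothing⇒Paired inc eq
... | false with pairGen-total x (ℕ.<-≤-trans x<y (ℕ.≤-pred (Finₚ.toℕ<n y)))
...   | i , gen with trans (sym eq) gen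
...     | ()

below-successor : ∀ {M k} {x y : Fin M} {w : Vec (Fin M) k} → toℕ y ≡ suc (toℕ x) → All (x ≢_) w →
  below y w ≡ below x w
below-successor {w = []}    _  _             = refl
below-successor {x = x} {y} {z ∷ w} y≡ (x≢z ∷ x∉w) rewrite y≡ =
  cong₂ _+_ (ltBit-suc (toℕ z) (toℕ x) (x≢z ∘ sym ∘ Finₚ.toℕ-injective)) (below-successor y≡ x∉w)

Paired⇒even : ∀ {n k} {v : Vec (Fin (suc n)) k} → Unique v → Paired v → even (inversions v) ≡ true
Paired⇒even {v = []}        _ _ = refl
Paired⇒even {v = _ ∷ []}    _ _ = refl
Paired⇒even {v = x ∷ y ∷ w} ((_ ∷ x∉w) ∷ (_ ∷ uw)) (x,y , p) with isPair-sound {x = x} {y} x,y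
... | _ , y≡ rewrite y≡ | ltBit-≥ {suc (toℕ x)} {toℕ x} (ℕ.n≤1+n _) | below-successor {w = w} y≡ x∉w =
  trans (even-double (below x w) (inversions w)) (Paired⇒even uw p)

InWJWithParity : ∀ {n} → Bool → Perm n → Set
InWJWithParity b v = (Unique v × Blockwise Fin._<_ v) × even (inversions v) ≡ b

toggle-odd : ∀ {n} {v : Perm n} → InWJWithParity false v → InWJWithParity true (toggle v)
toggle-odd {v = v} ((uv , inc) , odd) with firstUnpaired v in eq
... | nothing with trans (sym (Paired⇒even uv (firstUnpaired≡nothing⇒Paired inc eq))) odd
...   | ()
toggle-odd ((uv , inc) , odd) | just i =
  (Uniqueₚ.map⁺ (swap-injective i) uv , proj₂ (swap-firstUnpaired uv inc eq)) ,
  trans (even-inversions-lmul i uv) (cong not odd)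

toggle-Paired : ∀ {n} {v : Perm n} → Paired v → toggle v ≡ v
toggle-Paired p rewrite Paired⇒firstUnpaired≡nothing p = refl

Paired-toggle⇒fixed : ∀ {n} {v : Perm n} → Unique v → Blockwise Fin._<_ v → Paired (toggle v) → v ≡ toggle v
Paired-toggle⇒fixed uv inc paired = trans (sym (toggle-involutive uv inc)) (toggle-Paired paired)


-- The paired permutations

insertLowestPair : ∀ {M L} → Vec (Fin M) L → ℕ → Vec (Fin (2 + M)) (2 + L)
insertLowestPair w k = insertBlock k zero (suc zero) (map (2 ↑ʳ_) w)

pairedPerms : ∀ n → List (Perm n)
pairedPerms zero          = [ zero ∷ [] ]
pairedPerms (suc zero)    = [ zero ∷ suc zero ∷ [] ]
pairedPerms (suc (suc n)) =
  cartesianProductWith (λ w k → insertLowestPair w (toℕ k)) (pairedPerms n) (allFin (suc ⌈ n /2⌉))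

length-pairedPerms : ∀ n → length (pairedPerms n) ≡ ⌈ n /2⌉ !
length-pairedPerms zero          = refl
length-pairedPerms (suc zero)    = refl
length-pairedPerms (suc (suc n)) = begin
  length (pairedPerms (suc (suc n)))
    ≡⟨ length-cartesianProductWith _ (pairedPerms n) _ ⟩
  length (pairedPerms n) * length (allFin (suc ⌈ n /2⌉))
    ≡⟨ cong₂ _*_ (length-pairedPerms n) (Listₚ.length-tabulate id) ⟩
  ⌈ n /2⌉ ! * suc ⌈ n /2⌉
    ≡⟨ ℕ.*-comm (⌈ n /2⌉ !) (suc ⌈ n /2⌉) ⟩
  suc ⌈ n /2⌉ !
    ∎
  where open ≡-Reasoning

insertLowestPair-later : ∀ {M L} (w : Vec (Fin M) L) {k} → suc k + suc k ≤ L →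
  Vec.head (insertLowestPair w (suc k)) ≢ zero
insertLowestPair-later (_ ∷ [])    {k} k≤ = ⊥-elim (double-suc≰1 k k≤)
insertLowestPair-later (_ ∷ _ ∷ _)     _  = λ ()

insertLowestPair-injective : ∀ {M L} {w w′ : Vec (Fin M) L} {k k′} → k + k ≤ L → k′ + k′ ≤ L →
  insertLowestPair w k ≡ insertLowestPair w′ k′ → k ≡ k′ × w ≡ w′
insertLowestPair-injective {k = zero} {zero} _ _ eq =
  refl , map-injective (Finₚ.↑ʳ-injective 2 _ _) (Vecₚ.∷-injectiveʳ (Vecₚ.∷-injectiveʳ eq))
insertLowestPair-injective {w′ = w′} {zero} {suc k′} _ k′≤ eq =
  ⊥-elim (insertLowestPair-later w′ k′≤ (sym (cong Vec.head eq)))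
insertLowestPair-injective {w = w} {k = suc k} {zero} k≤ _ eq =
  ⊥-elim (insertLowestPair-later w k≤ (cong Vec.head eq))
insertLowestPair-injective {w = _ ∷ []} {k = suc k} {suc _} k≤ _ _ = ⊥-elim (double-suc≰1 k k≤)
insertLowestPair-injective {w = x ∷ y ∷ w} {x′ ∷ y′ ∷ w′} {suc k} {suc k′} k≤ k′≤ eq
  with Vecₚ.∷-injective eq
... | x≡ , eq′ with Vecₚ.∷-injective eq′
... | y≡ , eq″ with insertLowestPair-injective (double-pred k≤) (double-pred k′≤) eq″
... | refl , refl =
  refl , cong₂ _∷_ (Finₚ.↑ʳ-injective 2 x x′ x≡) (cong (_∷ w) (Finₚ.↑ʳ-injective 2 y y′ y≡))

pairedPerms-unique : ∀ n → ListUnique.Unique (pairedPerms n)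
pairedPerms-unique zero          = ListAll.[] ∷ []
pairedPerms-unique (suc zero)    = ListAll.[] ∷ []
pairedPerms-unique (suc (suc n)) =
  ListUniqueₚ.cartesianProductWith⁺ _ injective (pairedPerms-unique n) (ListUniqueₚ.allFin⁺ _)
  where
  in-range : ∀ (k : Fin (suc ⌈ n /2⌉)) → toℕ k + toℕ k ≤ suc n
  in-range k = ℕ.≤-trans (ℕ.+-mono-≤ k≤ k≤) (half+half≤ (suc n))
    where k≤ = ℕ.≤-pred (Finₚ.toℕ<n k)
  injective : ∀ {w w′ : Perm n} {k k′ : Fin (suc ⌈ n /2⌉)} →
    insertLowestPair w (toℕ k) ≡ insertLowestPair w′ (toℕ k′) → w ≡ w′ × k ≡ k′
  injective {k = k} {k′} eq with insertLowestPair-injective (in-range k) (in-range k′) eq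
  ... | k≡ , w≡ = w≡ , Finₚ.toℕ-injective k≡

insertLowestPair-unique : ∀ {M L} {w : Vec (Fin M) L} k → Unique w → Unique (insertLowestPair w k)
insertLowestPair-unique {w = w} k uw = insertBlock-unique k
  (((λ ()) ∷ avoids (λ _ ())) ∷ (avoids (λ _ ()) ∷ Uniqueₚ.map⁺ (Finₚ.↑ʳ-injective 2 _ _) uw))
  where
  avoids : ∀ {c} → (∀ x → c ≢ 2 ↑ʳ x) → All (c ≢_) (map (2 ↑ʳ_) w)
  avoids c∉ = AllProps.map⁺ (All.universal c∉ w)

pairedPerms-sound : ∀ n {c} → c ∈ pairedPerms n → (Unique c × Blockwise Fin._<_ c) × Paired c
pairedPerms-sound zero          (here refl) = (([] ∷ []) , tt) , tt
pairedPerms-sound (suc zero)    (here refl) = ((((λ ()) ∷ []) ∷ ([] ∷ [])) , (s≤s z≤n , tt)) , (refl , tt)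
pairedPerms-sound (suc (suc n)) c∈ with ∈-cartesianProductWith⁻ _ (pairedPerms n) (allFin (suc ⌈ n /2⌉)) c∈
... | w , k , w∈ , _ , refl with pairedPerms-sound n w∈
... | (uw , inc) , paired =
  (insertLowestPair-unique (toℕ k) uw ,
   Blockwise-insertBlock (toℕ k) (s≤s z≤n) (Blockwise-map (λ x<y → s≤s (s≤s x<y)) inc)) ,
  Blockwise-insertBlock (toℕ k) refl (Blockwise-map id paired)


-- The bipartition of G(W^J)

inWJWithParity? : ∀ {n} b (v : Perm n) → Dec (InWJWithParity b v)
inWJWithParity? b v =
  (AllPairs.allPairs? (λ x y → ¬? (x Finₚ.≟ y)) v ×-dec blockwise? Finₚ._<?_ v) ×-dec
  (even (inversions v) Boolₚ.≟ b)

vertices : ∀ n → Bool → List (Perm n)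
vertices n b = deduplicate (Vecₚ.≡-dec Finₚ._≟_) (filter (inWJWithParity? b) (allVecs (suc n) (suc n)))

vertices⁻ : ∀ {n b v} → v ∈ vertices n b → InWJWithParity b v
vertices⁻ {n} {b} v∈ =
  proj₂ (∈-filter⁻ (inWJWithParity? b) {xs = allVecs (suc n) (suc n)} (∈-deduplicate⁻ _ _ v∈))

vertices⁺ : ∀ {n b v} → InWJWithParity b v → v ∈ vertices n b
vertices⁺ {v = v} p = ∈-deduplicate⁺ _ (∈-filter⁺ (inWJWithParity? _) (∈-allVecs v) p)

vertices-unique : ∀ n b → ListUnique.Unique (vertices n b)
vertices-unique n b = ListUniqueDecₚ.deduplicate-! _ _

vertices-independent : ∀ n b → Independent (vertices n b)
vertices-independent n b x y x∈ y∈ (s , refl) with vertices⁻ x∈ | vertices⁻ y∈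
... | (ux , _) , x≡b | _ , y≡b = not-¬ refl (trans (sym y≡b) (trans (even-inversions-lmul s ux) (cong not x≡b)))

length-vertices : ∀ n → length (vertices n false) + ⌈ n /2⌉ ! ≤ length (vertices n true)
length-vertices n = begin
  length odd + ⌈ n /2⌉ !
    ≡⟨ cong₂ _+_ (Listₚ.length-map toggle odd) (length-pairedPerms n) ⟨
  length (List.map toggle odd) + length (pairedPerms n)
    ≡⟨ Listₚ.length-++ (List.map toggle odd) ⟨
  length (List.map toggle odd ++ pairedPerms n)
    ≤⟨ Unique-⊆⇒length-≤ unique ⊆even ⟩
  length (vertices n true)
    ∎
  where
  open ℕ.≤-Reasoning
  odd = vertices n false
  toggle-injective : ∀ {x y} → x ∈ odd → y ∈ odd → toggle x ≡ toggle y → x ≡ y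
  toggle-injective x∈ y∈ eq with vertices⁻ x∈ | vertices⁻ y∈
  ... | (ux , incx) , _ | (uy , incy) , _ =
    trans (sym (toggle-involutive ux incx)) (trans (cong toggle eq) (toggle-involutive uy incy))
  disjoint : ∀ {v} → ¬ (v ∈ List.map toggle odd × v ∈ pairedPerms n)
  disjoint (v∈ , v∈′) with ∈-map⁻ toggle v∈ | pairedPerms-sound n v∈′
  ... | w , w∈ , refl | (uv , _) , paired with vertices⁻ w∈
  ...   | (uw , incw) , w-odd with trans (sym w-odd) (trans (cong (even ∘ inversions) (Paired-toggle⇒fixed uw incw paired))
                                                       (Paired⇒even uv paired))
  ...   | ()
  unique : ListUnique.Unique (List.map toggle odd ++ pairedPerms n)
  unique = ListUniqueₚ.++⁺ (Unique-map⁺ toggle-injective (vertices-unique n false)) (pairedPerms-unique n) disjoint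
  ⊆even : ∀ {v} → v ∈ List.map toggle odd ++ pairedPerms n → v ∈ vertices n true
  ⊆even v∈ with ∈-++⁻ (List.map toggle odd) v∈
  ... | inj₁ v∈toggled with ∈-map⁻ toggle v∈toggled
  ...   | w , w∈ , refl = vertices⁺ (toggle-odd (vertices⁻ w∈))
  ⊆even v∈ | inj₂ v∈paired with pairedPerms-sound n v∈paired
  ... | (uv , inc) , paired = vertices⁺ ((uv , inc) , Paired⇒even uv paired)

everyOther-iota : ∀ n → IotaAtLeast (everyOther n) (⌈ n /2⌉ !)
everyOther-iota n =
  even-vs , odd-vs , vertices-unique n true , vertices-unique n false ,
  (λ x x∈ → inWJ (vertices⁻ x∈)) , (λ x x∈ → inWJ (vertices⁻ x∈)) ,
  cover , disjoint , vertices-independent n true , vertices-independent n false , length-vertices n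
  where
  even-vs = vertices n true
  odd-vs  = vertices n false
  inWJ : ∀ {b x} → InWJWithParity b x → InWJ (everyOther n) x
  inWJ ((ux , inc) , _) = InWJ⁺ ux inc
  cover : ∀ x → InWJ (everyOther n) x → x ∈ even-vs ⊎ x ∈ odd-vs
  cover x x∈WJ with even (inversions x) in parity
  ... | true  = inj₁ (vertices⁺ (InWJ⁻ x∈WJ , parity))
  ... | false = inj₂ (vertices⁺ (InWJ⁻ x∈WJ , parity))
  disjoint : ∀ x → x ∈ even-vs → x ∈ odd-vs → ⊥
  disjoint x x∈ x∈′ with trans (sym (proj₂ (vertices⁻ x∈))) (proj₂ (vertices⁻ x∈′))
  ... | ()

IotaAtLeast-mono : ∀ {n} {J : Subset n} {k k′} → k ≤ k′ → IotaAtLeast J k′ → IotaAtLeast J k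
IotaAtLeast-mono k≤k′ (A , B , uA , uB , A⊆ , B⊆ , cover , disjoint , indA , indB , bound) =
  A , B , uA , uB , A⊆ , B⊆ , cover , disjoint , indA , indB ,
  ℕ.≤-trans (ℕ.+-monoʳ-≤ (length B) k≤k′) bound

theorem6p6 : ∀ (n : ℕ) → ∃[ J ] (CubeLike {n} J × IotaAtLeast {n} J (⌈ n /2⌉ !))
theorem6p6 n =
  everyOther n ,
  (everyOther-abelian n , IotaAtLeast-mono (ℕ.1≤n! ⌈ n /2⌉) (everyOther-iota n)) ,
  everyOther-iota n
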